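{- Let $d, n, k$ be positive integers and let $T$ be a $d\times nk$ table in which each row contains each element of $[k]$ exactly $n$ times, whose columns are pairwise distinct and ordered lexicographically. Then $$\Delta_T(I_n) = AT_d(k,T),$$ where on the right $T$ is viewed as the set of its columns (a subset of $[k]^d$).
   Context: Tensors in $(\mathbb{C}^n)^{\otimes d}$ are hypermatrices; $I_n$ is the unit tensor with entries $1$ when all indices coincide and $0$ otherwise. For $\sigma:[nk]\to[n]$ and row $i$ of $T$, $\mathrm{sgn}_{T_i}(\sigma):=\prod_{b=1}^k\mathrm{sgn}(\sigma(j_{b,1}),\ldots,\sigma(j_{b,n}))$, where $j_{b,1}<\cdots<j_{b,n}$ are the positions with $T_{ij}=b$ and the sign of a sequence is its permutation sign if it is a permutation of $[n]$ and $0$ otherwise; $\Delta_T(X):=\sum_{\sigma_1,\ldots,\sigma_d:[nk]\to[n]}\prod_i\mathrm{sgn}_{T_i}(\sigma_i)\prod_{j=1}^{nk}X_{\sigma_1(j),\ldots,\sigma_d(j)}$. Cells of $[k]^d$ are ordered lexicographically; a slice in direction $\ell$ is the set of cells with fixed $\ell$-th coordinate. The set of columns of $T$ is a magic set (each slice contains exactly $n$ of its elements). A partial Latin hypercube of type $T$ is $C:[k]^d\to\{0,1,\ldots,n\}$ with $C(a)\neq0$ iff $a\in T$, such that in each slice the nonzero values, read in lexicographic order of the cells, form a permutation of $[n]$; $\mathrm{sgn}(C)$ is the product of the signs of these permutations over all $dk$ slices; $AT_d(k,T):=\sum_C\mathrm{sgn}(C)$ over all partial Latin hypercubes of type $T$.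 -}

module Defs where

open import Data.Bool using (Bool; true; false; _∧_; _∨_; not; if_then_else_)
open import Data.Nat as ℕ using (ℕ; zero; suc; _*_; _^_; _≤_; _<_)
open import Data.Fin as F using (Fin; toℕ)
open import Data.Fin.Properties using (_≟_)
open import Data.List as L using (List; []; _∷_; map; filter; length; allFin; upTo; concatMap; foldr)
open import Data.Vec.Functional as VF using ()
open import Data.Integer as ℤ using (ℤ; 0ℤ; 1ℤ; -1ℤ)
open import Data.Product using (Σ; _×_)
open import Relation.Nullary using (¬_; does)
open import Relation.Binary.PropositionalEquality using (_≡_)

sumℤ : List ℤ → ℤ
sumℤ = foldr ℤ._+_ 0ℤ

prodℤ : List ℤ → ℤ
prodℤ = foldr ℤ._*_ 1ℤ

[_] : Bool → ℤ
[ true ]  = 1ℤ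
[ false ] = 0ℤ

allB : {A : Set} → (A → Bool) → List A → Bool
allB p = foldr (λ x b → p x ∧ b) true

anyB : {A : Set} → (A → Bool) → List A → Bool
anyB p = foldr (λ x b → p x ∨ b) false

_==ᶠ_ : {m : ℕ} → Fin m → Fin m → Bool
x ==ᶠ y = does (x ≟ y)

_==ℕ_ : ℕ → ℕ → Bool
x ==ℕ y = does (x ℕ.≟ y)

-- All functions Fin m → A whose values lie in the given list, with the
-- first coordinate varying slowest: for xs in increasing order this is
-- the lexicographic order.
allFuns : {A : Set} (m : ℕ) → List A → List (Fin m → A)
allFuns zero    xs = (λ ()) ∷ []
allFuns (suc m) xs = concatMap (λ x → map (λ g → x VF.∷ g) (allFuns m xs)) xs

countℕ : ℕ → List ℕ → ℕ
countℕ m xs = length (filter (λ y → m ℕ.≟ y) xs)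

isPermB : ℕ → List ℕ → Bool
isPermB n xs = (length xs ==ℕ n) ∧ allB (λ m → countℕ (suc m) xs ==ℕ 1) (upTo n)

inversions : List ℕ → ℕ
inversions []       = 0
inversions (x ∷ xs) = length (filter (λ y → y ℕ.<? x) xs) ℕ.+ inversions xs

powℤ : ℤ → ℕ → ℤ
powℤ z zero    = 1ℤ
powℤ z (suc m) = z ℤ.* powℤ z m

seqSign : ℕ → List ℕ → ℤ
seqSign n xs = if isPermB n xs then powℤ -1ℤ (inversions xs) else 0ℤ

-- an element of Fin n read as an element of [n] = {1,…,n}
el : {n : ℕ} → Fin n → ℕ
el i = suc (toℕ i)

-- A d × N table with entries in [k] (Fin k stands for [k]); T i j is row i, column j.
Table : ℕ → ℕ → ℕ → Set
Table d N k = Fin d → Fin N → Fin k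

column : {d N k : ℕ} → Table d N k → Fin N → (Fin d → Fin k)
column T j i = T i j

positions : {d N k : ℕ} → Table d N k → Fin d → Fin k → List (Fin N)
positions T i b = filter (λ j → T i j ≟ b) (allFin _)

rowSign : {d N k : ℕ} (n : ℕ) → Table d N k → Fin d → (Fin N → Fin n) → ℤ
rowSign {k = k} n T i σ = prodℤ (map (λ b → seqSign n (map (λ j → el (σ j)) (positions T i b))) (allFin k))

-- Tensor in (ℂ^n)^{⊗d}, with integer entries (hypermatrix)
Tensor : ℕ → ℕ → Set
Tensor n d = (Fin d → Fin n) → ℤ

unitTensor : (n d : ℕ) → Tensor n d
unitTensor n d x = [ allB (λ i → allB (λ i' → x i ==ᶠ x i') (allFin d)) (allFin d) ]

Δ : {d N k : ℕ} (n : ℕ) → Table d N k → Tensor n d → ℤ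
Δ {d} {N} n T X =
  sumℤ (map (λ (σ : Fin d → Fin N → Fin n) →
               prodℤ (map (λ i → rowSign n T i (σ i)) (allFin d))
               ℤ.* prodℤ (map (λ j → X (λ i → σ i j)) (allFin N)))
            (allFuns d (allFuns N (allFin n))))

cells : (d k : ℕ) → List (Fin d → Fin k)
cells d k = allFuns d (allFin k)

ncells : ℕ → ℕ → ℕ
ncells d k = length (cells d k)

cell : {d k : ℕ} → Fin (ncells d k) → (Fin d → Fin k)
cell {d} {k} c = L.lookup (cells d k) c

inTableB : {d N k : ℕ} → Table d N k → (Fin d → Fin k) → Bool
inTableB {d} {N} T a = anyB (λ j → allB (λ i → T i j ==ᶠ a i) (allFin d)) (allFin N)

-- A filling of [k]^d with values in {0,…,n}, indexed by the (lexicographic)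
-- position of the cell: C c is the value at the cell  cell c.
Filling : ℕ → ℕ → ℕ → Set
Filling d k n = Fin (ncells d k) → Fin (suc n)

sliceValues : {d k n : ℕ} → Filling d k n → Fin d → Fin k → List ℕ
sliceValues {d} {k} C ℓ v =
  filter (λ x → 1 ℕ.≤? x)
    (map (λ c → toℕ (C c)) (filter (λ c → cell {d} {k} c ℓ ≟ v) (allFin (ncells d k))))

isPLH : {d N k : ℕ} (n : ℕ) → Table d N k → Filling d k n → Bool
isPLH {d} {N} {k} n T C =
  allB (λ c → not (toℕ (C c) ==ℕ 0) ∧ inTableB T (cell {d} {k} c) ∨ (toℕ (C c) ==ℕ 0) ∧ not (inTableB T (cell {d} {k} c)))
       (allFin (ncells d k))
  ∧ allB (λ ℓ → allB (λ v → isPermB n (sliceValues {d} {k} C ℓ v)) (allFin k)) (allFin d)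

signPLH : {d k : ℕ} (n : ℕ) → Filling d k n → ℤ
signPLH {d} {k} n C =
  prodℤ (map (λ ℓ → prodℤ (map (λ v → seqSign n (sliceValues {d} {k} C ℓ v)) (allFin k))) (allFin d))

AT : (d k : ℕ) {N : ℕ} (n : ℕ) → Table d N k → ℤ
AT d k n T =
  sumℤ (map (λ C → [ isPLH n T C ] ℤ.* signPLH {d} {k} n C)
            (allFuns (ncells d k) (allFin (suc n))))

RowsBalanced : {d N k : ℕ} (n : ℕ) → Table d N k → Set
RowsBalanced {d} {N} {k} n T = (i : Fin d) (b : Fin k) → length (positions T i b) ≡ n

ColumnsDistinct : {d N k : ℕ} → Table d N k → Set
ColumnsDistinct {d} {N} T = (j j′ : Fin N) → ¬ (j ≡ j′) → ¬ ((i : Fin d) → T i j ≡ T i j′)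

LexLt : {d k : ℕ} → (Fin d → Fin k) → (Fin d → Fin k) → Set
LexLt {d} a b = Σ (Fin d) λ i → ((i′ : Fin d) → i′ F.< i → a i′ ≡ b i′) × (a i F.< b i)

ColumnsLexOrdered : {d N k : ℕ} → Table d N k → Set
ColumnsLexOrdered {N = N} T = (j j′ : Fin N) → j F.< j′ → LexLt (column T j) (column T j′)

-- Both sides equal Σ_τ ∏_i sgn_{T_i}(τ), summed over τ : [nk] → [n]. In Δ_T(I_n) the unit
-- tensor kills every term in which σ₁, …, σ_d are not all equal. In AT_d(k,T) the sign of a
-- filling vanishes unless every slice reads a permutation, so only the support condition of a
-- partial Latin hypercube matters, and the fillings supported exactly on the columns of T are
-- those writing τ(j) into the j-th column. Cells are indexed by lexicographic rank; as the
-- columns of T increase lexicographically, the slice {a_ℓ = v} read in lexicographic order is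
-- τ read along the positions of v in row ℓ, which is the v-th factor of sgn_{T_ℓ}(τ).
module Submission where

open import Defs
open import Data.Bool using (Bool; true; false; _∧_; _∨_; not; if_then_else_; T)
open import Data.Bool.Properties using (T-∧; T-≡; ∧-identityʳ)
open import Data.Empty using (⊥-elim)
open import Data.Fin as F using (Fin; zero; suc; toℕ)
open import Data.Fin.Properties using (toℕ-injective; toℕ<n)
open import Data.Integer as ℤ using (ℤ; 0ℤ; 1ℤ)
open import Data.Integer.Properties as ℤP using ()
open import Data.List as L using (List; []; _∷_; map; filter; length; allFin; concatMap; _++_)
open import Data.List.Properties as LP using ()
open import Data.Nat as ℕ using (ℕ; zero; suc; _+_; _*_; _^_; _≤_; _<_; _≡ᵇ_; z≤n; s≤s; z<s; s<s)
open import Data.Nat.Properties as ℕP using ()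
open import Data.Product using (_,_; proj₁; proj₂)
import Data.Vec.Functional as VF
open import Function using (_∘_; id; case_of_; _⇔_; mk⇔; Equivalence)
open import Relation.Binary.Core using (_Preserves_⟶_)
open import Relation.Binary.Definitions using (Reflexive; tri<; tri≈; tri>)
open import Relation.Nullary using (¬_; does; yes; no)
open import Relation.Unary using (Decidable)
open import Relation.Binary.PropositionalEquality hiding ([_])
open ≡-Reasoning

∑ : ∀ {A : Set} → List A → (A → ℤ) → ℤ
∑ xs f = sumℤ (map f xs)

infixr 6 ∑
syntax ∑ xs (λ x → e) = ∑[ x ∈ xs ] e

sumℤ-++ : (xs ys : List ℤ) → sumℤ (xs ++ ys) ≡ sumℤ xs ℤ.+ sumℤ ys
sumℤ-++ []       ys = sym (ℤP.+-identityˡ _)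
sumℤ-++ (x ∷ xs) ys = trans (cong (ℤ._+_ x) (sumℤ-++ xs ys)) (sym (ℤP.+-assoc x _ _))

sumℤ-cong : ∀ {A : Set} {f g : A → ℤ} (xs : List A) → (∀ x → f x ≡ g x) →
            sumℤ (map f xs) ≡ sumℤ (map g xs)
sumℤ-cong xs f≗g = cong sumℤ (LP.map-cong f≗g xs)

prodℤ-cong : ∀ {A : Set} {f g : A → ℤ} (xs : List A) → (∀ x → f x ≡ g x) →
             prodℤ (map f xs) ≡ prodℤ (map g xs)
prodℤ-cong xs f≗g = cong prodℤ (LP.map-cong f≗g xs)

sumℤ-concatMap : ∀ {A B : Set} (f : B → ℤ) (g : A → List B) (xs : List A) →
                 sumℤ (map f (concatMap g xs)) ≡ ∑[ x ∈ xs ] sumℤ (map f (g x))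
sumℤ-concatMap f g []       = refl
sumℤ-concatMap f g (x ∷ xs) = begin
  sumℤ (map f (g x ++ concatMap g xs))
    ≡⟨ cong sumℤ (LP.map-++ f (g x) (concatMap g xs)) ⟩
  sumℤ (map f (g x) ++ map f (concatMap g xs))
    ≡⟨ sumℤ-++ (map f (g x)) _ ⟩
  sumℤ (map f (g x)) ℤ.+ sumℤ (map f (concatMap g xs))
    ≡⟨ cong (ℤ._+_ (sumℤ (map f (g x)))) (sumℤ-concatMap f g xs) ⟩
  ∑[ y ∈ x ∷ xs ] sumℤ (map f (g y)) ∎

sumℤ-*ʳ : ∀ {A : Set} (c : ℤ) (f : A → ℤ) (xs : List A) →
          ∑[ x ∈ xs ] f x ℤ.* c ≡ sumℤ (map f xs) ℤ.* c
sumℤ-*ʳ c f []       = sym (ℤP.*-zeroˡ c)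
sumℤ-*ʳ c f (x ∷ xs) =
  trans (cong (ℤ._+_ (f x ℤ.* c)) (sumℤ-*ʳ c f xs)) (sym (ℤP.*-distribʳ-+ c (f x) _))

sumℤ-zero : ∀ {A : Set} (f : A → ℤ) (xs : List A) → (∀ x → f x ≡ 0ℤ) → sumℤ (map f xs) ≡ 0ℤ
sumℤ-zero f []       f≡0 = refl
sumℤ-zero f (x ∷ xs) f≡0 = cong₂ ℤ._+_ (f≡0 x) (sumℤ-zero f xs f≡0)

[]-∧ : ∀ a b → [ a ∧ b ] ≡ [ a ] ℤ.* [ b ]
[]-∧ true  b = sym (ℤP.*-identityˡ _)
[]-∧ false b = refl

prodℤ-[] : ∀ {A : Set} (p : A → Bool) (xs : List A) → prodℤ (map (λ x → [ p x ]) xs) ≡ [ allB p xs ]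
prodℤ-[] p []       = refl
prodℤ-[] p (x ∷ xs) = trans (cong ([ p x ] ℤ.*_) (prodℤ-[] p xs)) (sym ([]-∧ (p x) (allB p xs)))

[]-∧-dropʳ : ∀ a b (s : ℤ) → (b ≡ false → s ≡ 0ℤ) → [ a ∧ b ] ℤ.* s ≡ [ a ] ℤ.* s
[]-∧-dropʳ a true  s _     = cong (λ b → [ b ] ℤ.* s) (∧-identityʳ a)
[]-∧-dropʳ a false s s≡0 rewrite s≡0 refl = trans (ℤP.*-zeroʳ [ a ∧ false ]) (sym (ℤP.*-zeroʳ [ a ]))

prodℤ-vanishes : ∀ {A : Set} (p : A → Bool) (f : A → ℤ) (xs : List A) → allB p xs ≡ false →
                 (∀ x → p x ≡ false → f x ≡ 0ℤ) → prodℤ (map f xs) ≡ 0ℤ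
prodℤ-vanishes p f (x ∷ xs) all≡false f≡0 with p x in px
... | false = cong (ℤ._* prodℤ (map f xs)) (f≡0 x px)
... | true  = trans (cong (f x ℤ.*_) (prodℤ-vanishes p f xs all≡false f≡0)) (ℤP.*-zeroʳ (f x))

T-injective : ∀ {a b} → T a ⇔ T b → a ≡ b
T-injective {true}  {true}  _     = refl
T-injective {true}  {false} a⇔b = ⊥-elim (Equivalence.to a⇔b _)
T-injective {false} {true}  a⇔b = ⊥-elim (Equivalence.from a⇔b _)
T-injective {false} {false} _     = refl

T-==ᶠ : ∀ {m} {x y : Fin m} → T (x ==ᶠ y) ⇔ x ≡ y
T-==ᶠ {x = x} {y} with x F.≟ y
... | yes x≡y = mk⇔ (λ _ → x≡y) _
... | no  x≢y = mk⇔ (λ ()) x≢y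

allFin-suc : ∀ {m} → allFin (suc m) ≡ zero ∷ map suc (allFin m)
allFin-suc = cong (zero ∷_) (sym (LP.map-tabulate id suc))

map-allFin-suc : ∀ {A : Set} {m} (h : Fin (suc m) → A) →
                 map h (allFin (suc m)) ≡ h zero ∷ map (h ∘ suc) (allFin m)
map-allFin-suc h = trans (cong (map h) allFin-suc) (cong (h zero ∷_) (sym (LP.map-∘ _)))

allB-map : ∀ {A B : Set} (p : B → Bool) (f : A → B) (xs : List A) → allB p (map f xs) ≡ allB (p ∘ f) xs
allB-map p f []       = refl
allB-map p f (x ∷ xs) = cong (p (f x) ∧_) (allB-map p f xs)

anyB-map : ∀ {A B : Set} (p : B → Bool) (f : A → B) (xs : List A) → anyB p (map f xs) ≡ anyB (p ∘ f) xs
anyB-map p f []       = refl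
anyB-map p f (x ∷ xs) = cong (p (f x) ∨_) (anyB-map p f xs)

allB-allFin-suc : ∀ {m} (p : Fin (suc m) → Bool) →
                  allB p (allFin (suc m)) ≡ p zero ∧ allB (p ∘ suc) (allFin m)
allB-allFin-suc p = trans (cong (allB p) allFin-suc) (cong (p zero ∧_) (allB-map p suc (allFin _)))

anyB-allFin-suc : ∀ {m} (p : Fin (suc m) → Bool) →
                  anyB p (allFin (suc m)) ≡ p zero ∨ anyB (p ∘ suc) (allFin m)
anyB-allFin-suc p = trans (cong (anyB p) allFin-suc) (cong (p zero ∨_) (anyB-map p suc (allFin _)))

allB-cong : ∀ {A : Set} {p q : A → Bool} (xs : List A) → (∀ x → p x ≡ q x) → allB p xs ≡ allB q xs
allB-cong []       p≗q = refl
allB-cong (x ∷ xs) p≗q = cong₂ _∧_ (p≗q x) (allB-cong xs p≗q)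

anyB-cong : ∀ {A : Set} {p q : A → Bool} (xs : List A) → (∀ x → p x ≡ q x) → anyB p xs ≡ anyB q xs
anyB-cong []       p≗q = refl
anyB-cong (x ∷ xs) p≗q = cong₂ _∨_ (p≗q x) (anyB-cong xs p≗q)

T-allB⁻ : ∀ {m} (p : Fin m → Bool) → T (allB p (allFin m)) → ∀ i → T (p i)
T-allB⁻ p t zero    rewrite allB-allFin-suc p = proj₁ (Equivalence.to T-∧ t)
T-allB⁻ p t (suc i) rewrite allB-allFin-suc p = T-allB⁻ (p ∘ suc) (proj₂ (Equivalence.to T-∧ t)) i

T-allB⁺ : ∀ {m} (p : Fin m → Bool) → (∀ i → T (p i)) → T (allB p (allFin m))
T-allB⁺ {zero}  p h = _
T-allB⁺ {suc m} p h rewrite allB-allFin-suc p = Equivalence.from T-∧ (h zero , T-allB⁺ (p ∘ suc) (h ∘ suc))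

allB-comm : ∀ {m m′} (p : Fin m → Fin m′ → Bool) →
            allB (λ i → allB (p i) (allFin m′)) (allFin m) ≡ allB (λ j → allB (λ i → p i j) (allFin m)) (allFin m′)
allB-comm {m} {m′} p = T-injective (mk⇔
  (λ t → T-allB⁺ _ λ j → T-allB⁺ _ λ i →
           T-allB⁻ (p i) (T-allB⁻ (λ i → allB (p i) (allFin m′)) t i) j)
  (λ t → T-allB⁺ _ λ i → T-allB⁺ _ λ j →
           T-allB⁻ (λ i → p i j) (T-allB⁻ (λ j → allB (λ i → p i j) (allFin m)) t j) i))

∷-pointwise : ∀ {A : Set} (_≈_ : A → A → Set) → Reflexive _≈_ → ∀ {M} (x : A) {g g′ : Fin M → A} →
              (∀ i → g i ≈ g′ i) → ∀ i → (x VF.∷ g) i ≈ (x VF.∷ g′) i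
∷-pointwise _≈_ ≈-refl x g≈g′ zero    = ≈-refl
∷-pointwise _≈_ ≈-refl x g≈g′ (suc i) = g≈g′ i

sumℤ-allFin-suc : ∀ {m} (f : Fin (suc m) → ℤ) →
                  sumℤ (map f (allFin (suc m))) ≡ f zero ℤ.+ sumℤ (map (f ∘ suc) (allFin m))
sumℤ-allFin-suc f = cong sumℤ (map-allFin-suc f)

sumℤ-allFuns-suc : ∀ {A : Set} {m} (xs : List A) (F : (Fin (suc m) → A) → ℤ) →
                   sumℤ (map F (allFuns (suc m) xs))
                   ≡ ∑[ x ∈ xs ] ∑[ g ∈ allFuns m xs ] F (x VF.∷ g)
sumℤ-allFuns-suc {m = m} xs F =
  trans (sumℤ-concatMap F (λ x → map (x VF.∷_) (allFuns m xs)) xs)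
        (sumℤ-cong xs (λ x → cong sumℤ (sym (LP.map-∘ (allFuns m xs)))))

delta-Fin : ∀ {n} (H : Fin n → ℤ) (y : Fin n) → ∑[ x ∈ allFin n ] H x ℤ.* [ x ==ᶠ y ] ≡ H y
delta-Fin {suc n} H zero = begin
  ∑[ x ∈ allFin (suc n) ] H x ℤ.* [ x ==ᶠ zero ]
    ≡⟨ sumℤ-allFin-suc (λ x → H x ℤ.* [ x ==ᶠ zero ]) ⟩
  H zero ℤ.* 1ℤ ℤ.+ (∑[ x ∈ allFin n ] H (suc x) ℤ.* 0ℤ)
    ≡⟨ cong₂ ℤ._+_ (ℤP.*-identityʳ (H zero)) (sumℤ-zero _ (allFin n) (ℤP.*-zeroʳ ∘ H ∘ suc)) ⟩
  H zero ℤ.+ 0ℤ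
    ≡⟨ ℤP.+-identityʳ (H zero) ⟩
  H zero ∎
delta-Fin {suc n} H (suc y) = begin
  ∑[ x ∈ allFin (suc n) ] H x ℤ.* [ x ==ᶠ suc y ]
    ≡⟨ sumℤ-allFin-suc (λ x → H x ℤ.* [ x ==ᶠ suc y ]) ⟩
  H zero ℤ.* 0ℤ ℤ.+ (∑[ x ∈ allFin n ] H (suc x) ℤ.* [ x ==ᶠ y ])
    ≡⟨ cong₂ ℤ._+_ (ℤP.*-zeroʳ (H zero)) (delta-Fin (H ∘ suc) y) ⟩
  0ℤ ℤ.+ H (suc y)
    ≡⟨ ℤP.+-identityˡ (H (suc y)) ⟩
  H (suc y) ∎

sumℤ-allFuns-delta :
  ∀ {A : Set} (_≈_ : A → A → Set) → Reflexive _≈_ → (eq : A → A → Bool) (xs : List A) →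
  (∀ (H : A → ℤ) → (∀ {x x′} → x ≈ x′ → H x ≡ H x′) → ∀ y →
     ∑[ x ∈ xs ] H x ℤ.* [ eq x y ] ≡ H y) →
  ∀ m (F : (Fin m → A) → ℤ) → (∀ {g g′} → (∀ i → g i ≈ g′ i) → F g ≡ F g′) → ∀ h →
  ∑[ g ∈ allFuns m xs ] F g ℤ.* [ allB (λ i → eq (g i) (h i)) (allFin m) ] ≡ F h
sumℤ-allFuns-delta _≈_ ≈-refl eq xs delta zero F F-resp h =
  trans (ℤP.+-identityʳ _) (trans (ℤP.*-identityʳ _) (F-resp (λ ())))
sumℤ-allFuns-delta {A} _≈_ ≈-refl eq xs delta (suc m) F F-resp h = begin
  ∑[ g ∈ allFuns (suc m) xs ] F g ℤ.* [ match g ]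
    ≡⟨ sumℤ-allFuns-suc xs _ ⟩
  ∑[ x ∈ xs ] ∑[ g ∈ allFuns m xs ] F (x VF.∷ g) ℤ.* [ match (x VF.∷ g) ]
    ≡⟨ sumℤ-cong xs (λ x → trans (sumℤ-cong (allFuns m xs) (split x)) (sumℤ-*ʳ _ _ (allFuns m xs))) ⟩
  ∑[ x ∈ xs ] (∑[ g ∈ allFuns m xs ] F (x VF.∷ g) ℤ.* [ matchTail g ]) ℤ.* [ eq x (h zero) ]
    ≡⟨ sumℤ-cong xs (λ x → cong (ℤ._* [ eq x (h zero) ])
         (sumℤ-allFuns-delta _≈_ ≈-refl eq xs delta m (λ g → F (x VF.∷ g))
            (F-resp ∘ ∷-pointwise _≈_ ≈-refl x) (h ∘ suc))) ⟩
  ∑[ x ∈ xs ] F (x VF.∷ (h ∘ suc)) ℤ.* [ eq x (h zero) ]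
    ≡⟨ delta (λ x → F (x VF.∷ (h ∘ suc))) (λ x≈x′ → F-resp λ { zero → x≈x′ ; (suc i) → ≈-refl }) (h zero) ⟩
  F (h zero VF.∷ (h ∘ suc))
    ≡⟨ F-resp (λ { zero → ≈-refl ; (suc i) → ≈-refl }) ⟩
  F h ∎
  where
  match : (Fin (suc m) → A) → Bool
  match g = allB (λ i → eq (g i) (h i)) (allFin (suc m))
  matchTail : (Fin m → A) → Bool
  matchTail g = allB (λ i → eq (g i) (h (suc i))) (allFin m)
  split : ∀ x g → F (x VF.∷ g) ℤ.* [ match (x VF.∷ g) ] ≡ (F (x VF.∷ g) ℤ.* [ matchTail g ]) ℤ.* [ eq x (h zero) ]
  split x g = begin
    F (x VF.∷ g) ℤ.* [ match (x VF.∷ g) ]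
      ≡⟨ cong (λ b → F (x VF.∷ g) ℤ.* [ b ]) (allB-allFin-suc (λ i → eq ((x VF.∷ g) i) (h i))) ⟩
    F (x VF.∷ g) ℤ.* [ eq x (h zero) ∧ matchTail g ]
      ≡⟨ cong (F (x VF.∷ g) ℤ.*_) (trans ([]-∧ (eq x (h zero)) _) (ℤP.*-comm [ eq x (h zero) ] _)) ⟩
    F (x VF.∷ g) ℤ.* ([ matchTail g ] ℤ.* [ eq x (h zero) ])
      ≡⟨ sym (ℤP.*-assoc (F (x VF.∷ g)) _ _) ⟩
    (F (x VF.∷ g) ℤ.* [ matchTail g ]) ℤ.* [ eq x (h zero) ] ∎

rowSigns : ∀ {d N k} n → Table d N k → (Fin N → Fin n) → ℤ
rowSigns {d} n T τ = prodℤ (map (λ i → rowSign n T i τ) (allFin d))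

rowSign-cong : ∀ {d N k} n (T : Table d N k) i {τ τ′ : Fin N → Fin n} →
               (∀ j → τ j ≡ τ′ j) → rowSign n T i τ ≡ rowSign n T i τ′
rowSign-cong {k = k} n T i τ≗τ′ =
  prodℤ-cong (allFin k) (λ b → cong (seqSign n) (LP.map-cong (cong el ∘ τ≗τ′) (positions T i b)))

unitTensor-suc : ∀ n d (z : Fin (suc d) → Fin n) →
                 unitTensor n (suc d) z ≡ [ allB (λ i → z (suc i) ==ᶠ z zero) (allFin d) ]
unitTensor-suc n d z = cong [_] (T-injective (mk⇔
  (λ t → T-allB⁺ _ λ i → T-allB⁻ (z (suc i) ==ᶠ_ ∘ z) (T-allB⁻ row t (suc i)) zero)
  (λ t → T-allB⁺ row λ i → T-allB⁺ (z i ==ᶠ_ ∘ z) λ i′ →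
     Equivalence.from T-==ᶠ (trans (≡-first t i) (sym (≡-first t i′))))))
  where
  row : Fin (suc d) → Bool
  row i = allB (λ i′ → z i ==ᶠ z i′) (allFin (suc d))
  ≡-first : T (allB (λ i → z (suc i) ==ᶠ z zero) (allFin d)) → ∀ i → z i ≡ z zero
  ≡-first t zero    = refl
  ≡-first t (suc i) = Equivalence.to T-==ᶠ (T-allB⁻ _ t i)

delta-allFuns : ∀ {n} N (F : (Fin N → Fin n) → ℤ) → (∀ {g g′} → (∀ j → g j ≡ g′ j) → F g ≡ F g′) →
                ∀ h → ∑[ g ∈ allFuns N (allFin n) ] F g ℤ.* [ allB (λ j → g j ==ᶠ h j) (allFin N) ] ≡ F h
delta-allFuns = sumℤ-allFuns-delta _≡_ refl _==ᶠ_ (allFin _) (λ H _ → delta-Fin H)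

Δ-unitTensor : ∀ {d N k} n (T : Table (suc d) N k) →
               Δ n T (unitTensor n (suc d)) ≡ ∑[ τ ∈ allFuns N (allFin n) ] rowSigns n T τ
Δ-unitTensor {d} {N} n T = begin
  Δ n T (unitTensor n (suc d))
    ≡⟨ sumℤ-allFuns-suc (allFuns N (allFin n)) _ ⟩
  ∑[ τ ∈ allFuns N (allFin n) ] ∑[ σ ∈ allFuns d (allFuns N (allFin n)) ] R (τ VF.∷ σ) ℤ.* U τ σ
    ≡⟨ sumℤ-cong (allFuns N (allFin n)) (λ τ → sumℤ-cong (allFuns d (allFuns N (allFin n))) λ σ →
         cong (R (τ VF.∷ σ) ℤ.*_) (unit-product τ σ)) ⟩
  ∑[ τ ∈ allFuns N (allFin n) ] ∑[ σ ∈ allFuns d (allFuns N (allFin n)) ] R (τ VF.∷ σ) ℤ.* [ equalsτ τ σ ]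
    ≡⟨ sumℤ-cong (allFuns N (allFin n)) (λ τ →
         sumℤ-allFuns-delta _ (λ _ → refl) (λ g h → allB (λ j → g j ==ᶠ h j) (allFin N)) (allFuns N (allFin n))
           (delta-allFuns N) d (λ σ → R (τ VF.∷ σ)) (λ σ≗σ′ → R-cong λ { zero j → refl ; (suc i) → σ≗σ′ i })
           (λ _ → τ)) ⟩
  ∑[ τ ∈ allFuns N (allFin n) ] R (τ VF.∷ (λ _ → τ))
    ≡⟨ sumℤ-cong (allFuns N (allFin n)) (λ τ → R-cong λ { zero j → refl ; (suc i) j → refl }) ⟩
  ∑[ τ ∈ allFuns N (allFin n) ] rowSigns n T τ ∎
  where
  R : (Fin (suc d) → Fin N → Fin n) → ℤ
  R σ = prodℤ (map (λ i → rowSign n T i (σ i)) (allFin (suc d)))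
  R-cong : ∀ {σ σ′} → (∀ i j → σ i j ≡ σ′ i j) → R σ ≡ R σ′
  R-cong σ≗σ′ = prodℤ-cong (allFin (suc d)) (λ i → rowSign-cong n T i (σ≗σ′ i))
  U : (Fin N → Fin n) → (Fin d → Fin N → Fin n) → ℤ
  U τ σ = prodℤ (map (λ j → unitTensor n (suc d) (λ i → (τ VF.∷ σ) i j)) (allFin N))
  equalsτ : (Fin N → Fin n) → (Fin d → Fin N → Fin n) → Bool
  equalsτ τ σ = allB (λ i → allB (λ j → σ i j ==ᶠ τ j) (allFin N)) (allFin d)
  unit-product : ∀ τ σ → U τ σ ≡ [ equalsτ τ σ ]
  unit-product τ σ = begin
    U τ σ
      ≡⟨ prodℤ-cong (allFin N) (λ j → unitTensor-suc n d (λ i → (τ VF.∷ σ) i j)) ⟩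
    prodℤ (map (λ j → [ allB (λ i → σ i j ==ᶠ τ j) (allFin d) ]) (allFin N))
      ≡⟨ prodℤ-[] _ (allFin N) ⟩
    [ allB (λ j → allB (λ i → σ i j ==ᶠ τ j) (allFin d)) (allFin N) ]
      ≡⟨ cong [_] (allB-comm (λ j i → σ i j ==ᶠ τ j)) ⟩
    [ equalsτ τ σ ] ∎

lexRank : ∀ {d k} → (Fin d → Fin k) → ℕ
lexRank {zero}      a = 0
lexRank {suc d} {k} a = toℕ (a zero) * k ^ d + lexRank (a ∘ suc)

range : ℕ → ℕ → List ℕ
range a zero    = []
range a (suc m) = a ∷ range (suc a) m

length-range : ∀ a m → length (range a m) ≡ m
length-range a zero    = refl
length-range a (suc m) = cong suc (length-range (suc a) m)

range-++ : ∀ a m m′ → range a m ++ range (a + m) m′ ≡ range a (m + m′)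
range-++ a zero    m′ = cong (λ b → range b m′) (ℕP.+-identityʳ a)
range-++ a (suc m) m′ =
  cong (a ∷_) (trans (cong (λ b → range (suc a) m ++ range b m′) (ℕP.+-suc a m)) (range-++ (suc a) m m′))

map-+-range : ∀ a b m → map (a +_) (range b m) ≡ range (a + b) m
map-+-range a b zero    = refl
map-+-range a b (suc m) =
  cong (a + b ∷_) (trans (map-+-range a (suc b) m) (cong (λ c → range c m) (ℕP.+-suc a b)))

concatMap-range : ∀ a K k → concatMap (λ i → range (a + toℕ i * K) K) (allFin k) ≡ range a (k * K)
concatMap-range a K zero    = refl
concatMap-range a K (suc k) = begin
  concatMap (λ i → range (a + toℕ i * K) K) (allFin (suc k))
    ≡⟨ cong L.concat (map-allFin-suc {m = k} (λ i → range (a + toℕ i * K) K)) ⟩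
  range (a + 0) K ++ concatMap (λ i → range (a + (K + toℕ i * K)) K) (allFin k)
    ≡⟨ cong₂ _++_ (cong (λ b → range b K) (ℕP.+-identityʳ a))
                  (LP.concatMap-cong (λ i → cong (λ b → range b K) (sym (ℕP.+-assoc a K (toℕ i * K)))) (allFin k)) ⟩
  range a K ++ concatMap (λ i → range (a + K + toℕ i * K) K) (allFin k)
    ≡⟨ cong (range a K ++_) (concatMap-range (a + K) K k) ⟩
  range a K ++ range (a + K) (k * K)
    ≡⟨ range-++ a K (k * K) ⟩
  range a (suc k * K) ∎

map-lexRank-cells : ∀ d k → map lexRank (cells d k) ≡ range 0 (k ^ d)
map-lexRank-cells zero    k = refl
map-lexRank-cells (suc d) k = begin
  map lexRank (concatMap (λ x → map (x VF.∷_) (cells d k)) (allFin k))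
    ≡⟨ LP.map-concatMap lexRank (λ x → map (x VF.∷_) (cells d k)) (allFin k) ⟩
  concatMap (λ x → map lexRank (map (x VF.∷_) (cells d k))) (allFin k)
    ≡⟨ LP.concatMap-cong block (allFin k) ⟩
  concatMap (λ x → range (0 + toℕ x * k ^ d) (k ^ d)) (allFin k)
    ≡⟨ concatMap-range 0 (k ^ d) k ⟩
  range 0 (k ^ suc d) ∎
  where
  block : ∀ x → map lexRank (map (x VF.∷_) (cells d k)) ≡ range (toℕ x * k ^ d) (k ^ d)
  block x = begin
    map lexRank (map (x VF.∷_) (cells d k))         ≡⟨ trans (sym (LP.map-∘ (cells d k))) (LP.map-∘ (cells d k)) ⟩
    map (toℕ x * k ^ d +_) (map lexRank (cells d k)) ≡⟨ cong (map (toℕ x * k ^ d +_)) (map-lexRank-cells d k) ⟩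
    map (toℕ x * k ^ d +_) (range 0 (k ^ d))         ≡⟨ map-+-range (toℕ x * k ^ d) 0 (k ^ d) ⟩
    range (toℕ x * k ^ d + 0) (k ^ d)                ≡⟨ cong (λ b → range b (k ^ d)) (ℕP.+-identityʳ _) ⟩
    range (toℕ x * k ^ d) (k ^ d)                    ∎

lookup-map-range : ∀ {A : Set} (f : A → ℕ) (xs : List A) a m → map f xs ≡ range a m →
                   ∀ i → f (L.lookup xs i) ≡ a + toℕ i
lookup-map-range f (x ∷ xs) a (suc m) eq zero    = trans (LP.∷-injectiveˡ eq) (sym (ℕP.+-identityʳ a))
lookup-map-range f (x ∷ xs) a (suc m) eq (suc i) =
  trans (lookup-map-range f xs (suc a) m (LP.∷-injectiveʳ eq) i) (sym (ℕP.+-suc a (toℕ i)))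

lexRank-cell : ∀ {d k} (c : Fin (ncells d k)) → lexRank (cell {d} {k} c) ≡ toℕ c
lexRank-cell {d} {k} = lookup-map-range lexRank (cells d k) 0 (k ^ d) (map-lexRank-cells d k)

ncells≡ : ∀ d k → ncells d k ≡ k ^ d
ncells≡ d k = begin
  length (cells d k)             ≡⟨ sym (LP.length-map lexRank (cells d k)) ⟩
  length (map lexRank (cells d k)) ≡⟨ cong length (map-lexRank-cells d k) ⟩
  length (range 0 (k ^ d))       ≡⟨ length-range 0 (k ^ d) ⟩
  k ^ d                          ∎

lexRank-< : ∀ {d k} (a : Fin d → Fin k) → lexRank a < k ^ d
lexRank-< {zero}      a = s≤s z≤n
lexRank-< {suc d} {k} a = ℕP.<-≤-trans (ℕP.+-monoʳ-< (toℕ (a zero) * k ^ d) (lexRank-< (a ∘ suc)))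
  (subst (_≤ k * k ^ d) (ℕP.+-comm (k ^ d) _) (ℕP.*-monoˡ-≤ (k ^ d) (toℕ<n (a zero))))

lexRank-<-head : ∀ {d k} (a b : Fin (suc d) → Fin k) → toℕ (a zero) < toℕ (b zero) → lexRank a < lexRank b
lexRank-<-head {d} {k} a b a₀<b₀ =
  ℕP.<-≤-trans (ℕP.+-monoʳ-< (toℕ (a zero) * k ^ d) (lexRank-< (a ∘ suc)))
    (subst (_≤ lexRank b) (ℕP.+-comm (k ^ d) (toℕ (a zero) * k ^ d))
      (ℕP.≤-trans (ℕP.*-monoˡ-≤ (k ^ d) a₀<b₀) (ℕP.m≤m+n _ _)))

lexRank-mono : ∀ {d k} {a b : Fin d → Fin k} → LexLt a b → lexRank a < lexRank b
lexRank-mono {suc d} {a = a} {b} (zero  , _    , aᵢ<bᵢ) = lexRank-<-head a b aᵢ<bᵢ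
lexRank-mono {suc d} {k} {a} {b} (suc i , a≡b<i , aᵢ<bᵢ) =
  subst (λ x → toℕ (a zero) * k ^ d + lexRank (a ∘ suc) < toℕ x * k ^ d + lexRank (b ∘ suc)) (a≡b<i zero z<s)
    (ℕP.+-monoʳ-< _ (lexRank-mono (i , (λ i′ i′<i → a≡b<i (suc i′) (s<s i′<i)) , aᵢ<bᵢ)))

lexRank-injective : ∀ {d k} (a b : Fin d → Fin k) → lexRank a ≡ lexRank b → ∀ i → a i ≡ b i
lexRank-injective {suc d} {k} a b eq i with ℕP.<-cmp (toℕ (a zero)) (toℕ (b zero))
... | tri< a₀<b₀ _ _ = ⊥-elim (ℕP.<-irrefl eq (lexRank-<-head a b a₀<b₀))
... | tri> _ _ b₀<a₀ = ⊥-elim (ℕP.<-irrefl (sym eq) (lexRank-<-head b a b₀<a₀))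
... | tri≈ _ a₀≡b₀ _ with i
...   | zero  = toℕ-injective a₀≡b₀
...   | suc i = lexRank-injective (a ∘ suc) (b ∘ suc)
                  (ℕP.+-cancelˡ-≡ (toℕ (a zero) * k ^ d) _ _
                    (trans eq (cong (λ x → x * k ^ d + lexRank (b ∘ suc)) (sym a₀≡b₀)))) i

lexRank-cong : ∀ {d k} {a b : Fin d → Fin k} → (∀ i → a i ≡ b i) → lexRank a ≡ lexRank b
lexRank-cong {zero}      a≗b = refl
lexRank-cong {suc d} {k} a≗b = cong₂ (λ x r → toℕ x * k ^ d + r) (a≗b zero) (lexRank-cong (a≗b ∘ suc))

allB-==ᶠ≡lexRank-≡ᵇ : ∀ {d k} (a b : Fin d → Fin k) → allB (λ i → a i ==ᶠ b i) (allFin d) ≡ (lexRank a ≡ᵇ lexRank b)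
allB-==ᶠ≡lexRank-≡ᵇ {d} a b = T-injective (mk⇔
  (λ t → ℕP.≡⇒≡ᵇ _ _ (lexRank-cong {a = a} {b} (Equivalence.to T-==ᶠ ∘ T-allB⁻ a==b t)))
  (λ t → T-allB⁺ a==b (Equivalence.from T-==ᶠ ∘ lexRank-injective a b (ℕP.≡ᵇ⇒≡ _ _ t))))
  where
  a==b : Fin d → Bool
  a==b i = a i ==ᶠ b i

-- Values are shifted by one so that 0 marks an empty cell: fill ι τ (ι j) = suc (τ j),
-- and fill ι τ x = 0 off the image of ι.
fill : ∀ {N n} → (Fin N → ℕ) → (Fin N → Fin n) → ℕ → Fin (suc n)
fill {zero}  ι τ x = zero
fill {suc N} ι τ x = if ι zero ≡ᵇ x then suc (τ zero) else fill (ι ∘ suc) (τ ∘ suc) x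

fillFrom : ∀ {N n M} → ℕ → (Fin N → ℕ) → (Fin N → Fin n) → Fin M → Fin (suc n)
fillFrom a ι τ c = fill ι τ (a + toℕ c)

inImage : ∀ {N} → (Fin N → ℕ) → ℕ → Bool
inImage {N} ι x = anyB (λ j → ι j ≡ᵇ x) (allFin N)

nonzeroIff : ∀ {n} → Fin (suc n) → Bool → Bool
nonzeroIff x b = not (toℕ x ==ℕ 0) ∧ b ∨ (toℕ x ==ℕ 0) ∧ not b

supportIsImage : ∀ {M N n} → ℕ → (Fin N → ℕ) → (Fin M → Fin (suc n)) → Bool
supportIsImage {M} a ι C = allB (λ c → nonzeroIff (C c) (inImage ι (a + toℕ c))) (allFin M)

≡⇒≡ᵇ≡true : ∀ {m n} → m ≡ n → (m ≡ᵇ n) ≡ true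
≡⇒≡ᵇ≡true {m} {n} m≡n = Equivalence.to T-≡ (ℕP.≡⇒≡ᵇ m n m≡n)

≢⇒≡ᵇ≡false : ∀ {m n} → m ≢ n → (m ≡ᵇ n) ≡ false
≢⇒≡ᵇ≡false {m} {n} m≢n with m ≡ᵇ n in eq
... | true  = ⊥-elim (m≢n (ℕP.≡ᵇ⇒≡ m n (subst T (sym eq) _)))
... | false = refl

fill-first : ∀ {N n} (ι : Fin (suc N) → ℕ) (τ : Fin (suc N) → Fin n) {x} → ι zero ≡ x →
             fill ι τ x ≡ suc (τ zero)
fill-first ι τ ι₀≡x rewrite ≡⇒≡ᵇ≡true ι₀≡x = refl

fill-skip : ∀ {N n} (ι : Fin (suc N) → ℕ) (τ : Fin (suc N) → Fin n) {x} → ι zero ≢ x →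
            fill ι τ x ≡ fill (ι ∘ suc) (τ ∘ suc) x
fill-skip ι τ ι₀≢x rewrite ≢⇒≡ᵇ≡false ι₀≢x = refl

fill-outside : ∀ {N n} (ι : Fin N → ℕ) (τ : Fin N → Fin n) {x} → (∀ j → ι j ≢ x) → fill ι τ x ≡ zero
fill-outside {zero}  ι τ ι≢x = refl
fill-outside {suc N} ι τ ι≢x = trans (fill-skip ι τ (ι≢x zero)) (fill-outside (ι ∘ suc) (τ ∘ suc) (ι≢x ∘ suc))

inImage-first : ∀ {N} (ι : Fin (suc N) → ℕ) {x} → ι zero ≡ x → inImage ι x ≡ true
inImage-first ι {x} ι₀≡x rewrite anyB-allFin-suc (λ j → ι j ≡ᵇ x) | ≡⇒≡ᵇ≡true ι₀≡x = refl

inImage-skip : ∀ {N} (ι : Fin (suc N) → ℕ) {x} → ι zero ≢ x → inImage ι x ≡ inImage (ι ∘ suc) x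
inImage-skip ι {x} ι₀≢x rewrite anyB-allFin-suc (λ j → ι j ≡ᵇ x) | ≢⇒≡ᵇ≡false ι₀≢x = refl

inImage-outside : ∀ {N} (ι : Fin N → ℕ) {x} → (∀ j → ι j ≢ x) → inImage ι x ≡ false
inImage-outside {zero}  ι ι≢x = refl
inImage-outside {suc N} ι ι≢x = trans (inImage-skip ι (ι≢x zero)) (inImage-outside (ι ∘ suc) (ι≢x ∘ suc))

<-+-suc : ∀ {x} a {M} → x < a + suc M → x < suc a + M
<-+-suc {x} a {M} = subst (x <_) (ℕP.+-suc a M)

data FirstOrBelow (a : ℕ) : ∀ {N} → (Fin N → ℕ) → Set where
  first : ∀ {N} {ι : Fin (suc N) → ℕ} → ι zero ≡ a → FirstOrBelow a ι
  below : ∀ {N} {ι : Fin N → ℕ} → (∀ j → a < ι j) → FirstOrBelow a ι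

firstOrBelow : ∀ {N} (ι : Fin N → ℕ) {a} → ι Preserves F._<_ ⟶ _<_ → (∀ j → a ≤ ι j) → FirstOrBelow a ι
firstOrBelow {zero}  ι     ι-mono a≤ι = below (λ ())
firstOrBelow {suc N} ι {a} ι-mono a≤ι with ι zero ℕ.≟ a
... | yes ι₀≡a = first ι₀≡a
... | no  ι₀≢a = let a<ι₀ = ℕP.≤∧≢⇒< (a≤ι zero) (ι₀≢a ∘ sym) in
                 below λ { zero → a<ι₀ ; (suc j) → ℕP.<-trans a<ι₀ (ι-mono z<s) }

mono-∘suc : ∀ {N} {ι : Fin (suc N) → ℕ} → ι Preserves F._<_ ⟶ _<_ → (ι ∘ suc) Preserves F._<_ ⟶ _<_
mono-∘suc ι-mono j<j′ = ι-mono (s<s j<j′)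

first<tail : ∀ {N a} {ι : Fin (suc N) → ℕ} → ι Preserves F._<_ ⟶ _<_ → ι zero ≡ a → ∀ j → a < ι (suc j)
first<tail ι-mono ι₀≡a j = subst (_< _) ι₀≡a (ι-mono z<s)

module _ {N n M : ℕ} {a : ℕ} where

  fillFrom-below : {ι : Fin N → ℕ} (τ : Fin N → Fin n) → (∀ j → a < ι j) →
                   ∀ (c : Fin (suc M)) → fillFrom a ι τ c ≡ (zero VF.∷ fillFrom (suc a) ι τ) c
  fillFrom-below {ι} τ a<ι zero    =
    fill-outside ι τ (λ j ιⱼ≡a+0 → ℕP.<⇒≢ (a<ι j) (sym (trans ιⱼ≡a+0 (ℕP.+-identityʳ a))))
  fillFrom-below {ι} τ a<ι (suc c) = cong (fill ι τ) (ℕP.+-suc a (toℕ c))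

  supportIsImage-∷ : (ι : Fin N → ℕ) (x : Fin (suc n)) (C : Fin M → Fin (suc n)) →
                     supportIsImage a ι (x VF.∷ C) ≡ nonzeroIff x (inImage ι a) ∧ supportIsImage (suc a) ι C
  supportIsImage-∷ ι x C = trans (allB-allFin-suc (λ c → nonzeroIff ((x VF.∷ C) c) (inImage ι (a + toℕ c))))
    (cong₂ (λ y b → nonzeroIff x (inImage ι y) ∧ b) (ℕP.+-identityʳ a)
           (allB-cong (allFin M) (λ c → cong (nonzeroIff (C c) ∘ inImage ι) (ℕP.+-suc a (toℕ c)))))

  supportIsImage-below : {ι : Fin N → ℕ} → (∀ j → a < ι j) → (x : Fin (suc n)) (C : Fin M → Fin (suc n)) →
                         supportIsImage a ι (x VF.∷ C) ≡ nonzeroIff x false ∧ supportIsImage (suc a) ι C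
  supportIsImage-below {ι} a<ι x C = trans (supportIsImage-∷ ι x C)
    (cong (λ b → nonzeroIff x b ∧ supportIsImage (suc a) ι C) (inImage-outside ι (ℕP.>⇒≢ ∘ a<ι)))

module _ {N n M : ℕ} {a : ℕ} (ι : Fin (suc N) → ℕ) (ι₀≡a : ι zero ≡ a) where

  private
    ι₀≢a+suc : ∀ c → ι zero ≢ a + suc c
    ι₀≢a+suc c ι₀≡a+suc = ℕP.m≢1+m+n a (trans (sym ι₀≡a) (trans ι₀≡a+suc (ℕP.+-suc a c)))

  fillFrom-first : (τ : Fin (suc N) → Fin n) →
                   ∀ (c : Fin (suc M)) → fillFrom a ι τ c ≡ (suc (τ zero) VF.∷ fillFrom (suc a) (ι ∘ suc) (τ ∘ suc)) c
  fillFrom-first τ zero    = fill-first ι τ (trans ι₀≡a (sym (ℕP.+-identityʳ a)))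
  fillFrom-first τ (suc c) =
    trans (fill-skip ι τ (ι₀≢a+suc (toℕ c))) (cong (fill (ι ∘ suc) (τ ∘ suc)) (ℕP.+-suc a (toℕ c)))

  supportIsImage-first : (x : Fin (suc n)) (C : Fin M → Fin (suc n)) →
                         supportIsImage a ι (x VF.∷ C) ≡ nonzeroIff x true ∧ supportIsImage (suc a) (ι ∘ suc) C
  supportIsImage-first x C = trans (supportIsImage-∷ ι x C)
    (cong₂ (λ b b′ → nonzeroIff x b ∧ b′) (inImage-first ι ι₀≡a)
           (allB-cong (allFin M) (λ c → cong (nonzeroIff (C c))
             (inImage-skip ι (λ ι₀≡ → ι₀≢a+suc (toℕ c) (trans ι₀≡ (sym (ℕP.+-suc a (toℕ c)))))))))

sumℤ-nonzeroIff-false : ∀ {A : Set} {n} (xs : List A) (s : A → Bool) (H : Fin (suc n) → A → ℤ) →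
  ∑[ x ∈ allFin (suc n) ] ∑[ C ∈ xs ] [ nonzeroIff x false ∧ s C ] ℤ.* H x C
  ≡ ∑[ C ∈ xs ] [ s C ] ℤ.* H zero C
sumℤ-nonzeroIff-false {n = n} xs s H = begin
  ∑[ x ∈ allFin (suc n) ] ∑[ C ∈ xs ] [ nonzeroIff x false ∧ s C ] ℤ.* H x C
    ≡⟨ sumℤ-allFin-suc (λ x → ∑[ C ∈ xs ] [ nonzeroIff x false ∧ s C ] ℤ.* H x C) ⟩
  (∑[ C ∈ xs ] [ s C ] ℤ.* H zero C) ℤ.+ (∑[ y ∈ allFin n ] (∑[ C ∈ xs ] 0ℤ ℤ.* H (suc y) C))
    ≡⟨ cong (ℤ._+_ (∑[ C ∈ xs ] [ s C ] ℤ.* H zero C))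
         (sumℤ-zero _ (allFin n) (λ y → sumℤ-zero _ xs (λ C → ℤP.*-zeroˡ (H (suc y) C)))) ⟩
  (∑[ C ∈ xs ] [ s C ] ℤ.* H zero C) ℤ.+ 0ℤ
    ≡⟨ ℤP.+-identityʳ _ ⟩
  ∑[ C ∈ xs ] [ s C ] ℤ.* H zero C ∎

sumℤ-nonzeroIff-true : ∀ {A : Set} {n} (xs : List A) (s : A → Bool) (H : Fin (suc n) → A → ℤ) →
  ∑[ x ∈ allFin (suc n) ] ∑[ C ∈ xs ] [ nonzeroIff x true ∧ s C ] ℤ.* H x C
  ≡ ∑[ y ∈ allFin n ] ∑[ C ∈ xs ] [ s C ] ℤ.* H (suc y) C
sumℤ-nonzeroIff-true {n = n} xs s H = begin
  ∑[ x ∈ allFin (suc n) ] ∑[ C ∈ xs ] [ nonzeroIff x true ∧ s C ] ℤ.* H x C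
    ≡⟨ sumℤ-allFin-suc (λ x → ∑[ C ∈ xs ] [ nonzeroIff x true ∧ s C ] ℤ.* H x C) ⟩
  (∑[ C ∈ xs ] 0ℤ ℤ.* H zero C) ℤ.+ (∑[ y ∈ allFin n ] (∑[ C ∈ xs ] [ s C ] ℤ.* H (suc y) C))
    ≡⟨ cong₂ ℤ._+_ (sumℤ-zero _ xs (λ C → ℤP.*-zeroˡ (H zero C))) refl ⟩
  0ℤ ℤ.+ (∑[ y ∈ allFin n ] (∑[ C ∈ xs ] [ s C ] ℤ.* H (suc y) C))
    ≡⟨ ℤP.+-identityˡ _ ⟩
  ∑[ y ∈ allFin n ] ∑[ C ∈ xs ] [ s C ] ℤ.* H (suc y) C ∎

sumℤ-supportIsImage :
  ∀ {n} M a {N} (ι : Fin N → ℕ) → ι Preserves F._<_ ⟶ _<_ → (∀ j → a ≤ ι j) → (∀ j → ι j < a + M) →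
  (G : (Fin M → Fin (suc n)) → ℤ) → (∀ {C C′} → (∀ c → C c ≡ C′ c) → G C ≡ G C′) →
  ∑[ C ∈ allFuns M (allFin (suc n)) ] [ supportIsImage a ι C ] ℤ.* G C
  ≡ ∑[ τ ∈ allFuns N (allFin n) ] G (fillFrom a ι τ)
sumℤ-supportIsImage zero a {zero} ι ι-mono a≤ι ι<a+M G G-cong =
  cong (ℤ._+ 0ℤ) (trans (ℤP.*-identityˡ _) (G-cong (λ ())))
sumℤ-supportIsImage zero a {suc N} ι ι-mono a≤ι ι<a+M G G-cong =
  ⊥-elim (ℕP.≤⇒≯ (a≤ι zero) (subst (ι zero <_) (ℕP.+-identityʳ a) (ι<a+M zero)))
sumℤ-supportIsImage {n} (suc M) a ι ι-mono a≤ι ι<a+M G G-cong with firstOrBelow ι ι-mono a≤ι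
... | below a<ι = begin
  ∑[ C ∈ allFuns (suc M) (allFin (suc n)) ] [ supportIsImage a ι C ] ℤ.* G C
    ≡⟨ sumℤ-allFuns-suc {m = M} (allFin (suc n)) _ ⟩
  ∑[ x ∈ allFin (suc n) ] ∑[ C ∈ Cs ] [ supportIsImage a ι (x VF.∷ C) ] ℤ.* G (x VF.∷ C)
    ≡⟨ sumℤ-cong (allFin (suc n)) (λ x → sumℤ-cong Cs λ C →
         cong (λ b → [ b ] ℤ.* G (x VF.∷ C)) (supportIsImage-below a<ι x C)) ⟩
  ∑[ x ∈ allFin (suc n) ] ∑[ C ∈ Cs ] [ nonzeroIff x false ∧ supportIsImage (suc a) ι C ] ℤ.* G (x VF.∷ C)
    ≡⟨ sumℤ-nonzeroIff-false Cs (supportIsImage (suc a) ι) (λ x C → G (x VF.∷ C)) ⟩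
  ∑[ C ∈ Cs ] [ supportIsImage (suc a) ι C ] ℤ.* G (zero VF.∷ C)
    ≡⟨ sumℤ-supportIsImage M (suc a) ι ι-mono a<ι (<-+-suc a ∘ ι<a+M)
         (G ∘ (zero VF.∷_)) (G-cong ∘ ∷-pointwise _≡_ refl (zero {n})) ⟩
  ∑[ τ ∈ allFuns _ (allFin n) ] G (zero VF.∷ fillFrom (suc a) ι τ)
    ≡⟨ sumℤ-cong (allFuns _ (allFin n)) (λ τ → G-cong (sym ∘ fillFrom-below τ a<ι)) ⟩
  ∑[ τ ∈ allFuns _ (allFin n) ] G (fillFrom a ι τ) ∎
  where
  Cs = allFuns M (allFin (suc n))
... | first ι₀≡a = begin
  ∑[ C ∈ allFuns (suc M) (allFin (suc n)) ] [ supportIsImage a ι C ] ℤ.* G C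
    ≡⟨ sumℤ-allFuns-suc {m = M} (allFin (suc n)) _ ⟩
  ∑[ x ∈ allFin (suc n) ] ∑[ C ∈ Cs ] [ supportIsImage a ι (x VF.∷ C) ] ℤ.* G (x VF.∷ C)
    ≡⟨ sumℤ-cong (allFin (suc n)) (λ x → sumℤ-cong Cs λ C →
         cong (λ b → [ b ] ℤ.* G (x VF.∷ C)) (supportIsImage-first ι ι₀≡a x C)) ⟩
  ∑[ x ∈ allFin (suc n) ] ∑[ C ∈ Cs ] [ nonzeroIff x true ∧ supportIsImage (suc a) (ι ∘ suc) C ] ℤ.* G (x VF.∷ C)
    ≡⟨ sumℤ-nonzeroIff-true Cs (supportIsImage (suc a) (ι ∘ suc)) (λ x C → G (x VF.∷ C)) ⟩
  ∑[ y ∈ allFin n ] ∑[ C ∈ Cs ] [ supportIsImage (suc a) (ι ∘ suc) C ] ℤ.* G (suc y VF.∷ C)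
    ≡⟨ sumℤ-cong (allFin n) (λ y → sumℤ-supportIsImage M (suc a) (ι ∘ suc) (mono-∘suc ι-mono)
         (first<tail ι-mono ι₀≡a) (<-+-suc a ∘ ι<a+M ∘ suc)
         (G ∘ (suc y VF.∷_)) (G-cong ∘ ∷-pointwise _≡_ refl (suc y))) ⟩
  ∑[ y ∈ allFin n ] ∑[ τ ∈ allFuns _ (allFin n) ] G (suc y VF.∷ fillFrom (suc a) (ι ∘ suc) τ)
    ≡⟨ sumℤ-cong (allFin n) (λ y → sumℤ-cong (allFuns _ (allFin n)) λ τ →
         G-cong (sym ∘ fillFrom-first ι ι₀≡a (y VF.∷ τ))) ⟩
  ∑[ y ∈ allFin n ] ∑[ τ ∈ allFuns _ (allFin n) ] G (fillFrom a ι (y VF.∷ τ))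
    ≡⟨ sym (sumℤ-allFuns-suc (allFin n) (λ τ → G (fillFrom a ι τ))) ⟩
  ∑[ τ ∈ allFuns _ (allFin n) ] G (fillFrom a ι τ) ∎
  where
  Cs = allFuns M (allFin (suc n))

filter-map : ∀ {A B : Set} {P : B → Set} (P? : Decidable P) (f : A → B) (xs : List A) →
             filter P? (map f xs) ≡ map f (filter (P? ∘ f) xs)
filter-map P? f []       = refl
filter-map P? f (x ∷ xs) with does (P? (f x))
... | true  = cong (f x ∷_) (filter-map P? f xs)
... | false = filter-map P? f xs

module _ {M : ℕ} {B : Set} {Q : Fin (suc M) → Set} (Q? : Decidable Q) (h : Fin (suc M) → B) where

  map-filter-allFin-accept : Q zero → map h (filter Q? (allFin (suc M))) ≡ h zero ∷ map (h ∘ suc) (filter (Q? ∘ suc) (allFin M))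
  map-filter-allFin-accept q = begin
    map h (filter Q? (allFin (suc M)))                     ≡⟨ cong (map h ∘ filter Q?) allFin-suc ⟩
    map h (filter Q? (zero ∷ map suc (allFin M)))          ≡⟨ cong (map h) (LP.filter-accept Q? q) ⟩
    h zero ∷ map h (filter Q? (map suc (allFin M)))        ≡⟨ cong (λ xs → h zero ∷ map h xs) (filter-map Q? suc (allFin M)) ⟩
    h zero ∷ map h (map suc (filter (Q? ∘ suc) (allFin M))) ≡⟨ cong (h zero ∷_) (sym (LP.map-∘ _)) ⟩
    h zero ∷ map (h ∘ suc) (filter (Q? ∘ suc) (allFin M))  ∎

  map-filter-allFin-reject : ¬ Q zero → map h (filter Q? (allFin (suc M))) ≡ map (h ∘ suc) (filter (Q? ∘ suc) (allFin M))
  map-filter-allFin-reject ¬q = begin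
    map h (filter Q? (allFin (suc M)))            ≡⟨ cong (map h ∘ filter Q?) allFin-suc ⟩
    map h (filter Q? (zero ∷ map suc (allFin M))) ≡⟨ cong (map h) (LP.filter-reject Q? ¬q) ⟩
    map h (filter Q? (map suc (allFin M)))        ≡⟨ cong (map h) (filter-map Q? suc (allFin M)) ⟩
    map h (map suc (filter (Q? ∘ suc) (allFin M))) ≡⟨ sym (LP.map-∘ _) ⟩
    map (h ∘ suc) (filter (Q? ∘ suc) (allFin M))  ∎

filter-fillFrom :
  ∀ {n k} M a {N} (ι : Fin N → ℕ) → ι Preserves F._<_ ⟶ _<_ → (∀ j → a ≤ ι j) → (∀ j → ι j < a + M) →
  (label : Fin M → Fin k) (label′ : Fin N → Fin k) → (∀ c j → a + toℕ c ≡ ι j → label c ≡ label′ j) →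
  (v : Fin k) (τ : Fin N → Fin n) →
  filter (1 ℕ.≤?_) (map (toℕ ∘ fillFrom a ι τ) (filter (λ c → label c F.≟ v) (allFin M)))
  ≡ map (el ∘ τ) (filter (λ j → label′ j F.≟ v) (allFin N))
filter-fillFrom zero a {zero} ι ι-mono a≤ι ι<a+M label label′ link v τ = refl
filter-fillFrom zero a {suc N} ι ι-mono a≤ι ι<a+M label label′ link v τ =
  ⊥-elim (ℕP.≤⇒≯ (a≤ι zero) (subst (ι zero <_) (ℕP.+-identityʳ a) (ι<a+M zero)))
filter-fillFrom (suc M) a ι ι-mono a≤ι ι<a+M label label′ link v τ with firstOrBelow ι ι-mono a≤ι
... | below a<ι = case label zero F.≟ v of λ where
    (yes q) → begin
      filter pos (map h (filter Q? (allFin (suc M))))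
        ≡⟨ cong (filter pos) (map-filter-allFin-accept Q? h q) ⟩
      filter pos (h zero ∷ map (h ∘ suc) L)
        ≡⟨ cong (λ x → filter pos (toℕ x ∷ map (h ∘ suc) L)) (fillFrom-below {M = M} τ a<ι zero) ⟩
      filter pos (map (h ∘ suc) L)
        ≡⟨ rest ⟩
      map (el ∘ τ) (filter P? (allFin _)) ∎
    (no ¬q) → trans (cong (filter pos) (map-filter-allFin-reject Q? h ¬q)) rest
  where
  pos = 1 ℕ.≤?_
  Q? = λ c → label c F.≟ v
  P? = λ j → label′ j F.≟ v
  h : Fin (suc M) → ℕ
  h = toℕ ∘ fillFrom a ι τ
  L = filter (Q? ∘ suc) (allFin M)
  rest : filter pos (map (h ∘ suc) L) ≡ map (el ∘ τ) (filter P? (allFin _))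
  rest = trans (cong (filter pos) (LP.map-cong (cong toℕ ∘ fillFrom-below τ a<ι ∘ suc) L))
               (filter-fillFrom M (suc a) ι ι-mono a<ι (<-+-suc a ∘ ι<a+M) (label ∘ suc) label′
                  (λ c j e → link (suc c) j (trans (ℕP.+-suc a (toℕ c)) e)) v τ)
... | first ι₀≡a = case label zero F.≟ v of λ where
    (yes q) → begin
      filter pos (map h (filter Q? (allFin (suc M))))
        ≡⟨ cong (filter pos) (map-filter-allFin-accept Q? h q) ⟩
      filter pos (h zero ∷ map (h ∘ suc) L)
        ≡⟨ cong (λ x → filter pos (toℕ x ∷ map (h ∘ suc) L)) (fillFrom-first {M = M} ι ι₀≡a τ zero) ⟩
      el (τ zero) ∷ filter pos (map (h ∘ suc) L)
        ≡⟨ cong (el (τ zero) ∷_) rest ⟩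
      el (τ zero) ∷ map (el ∘ τ ∘ suc) (filter (P? ∘ suc) (allFin _))
        ≡⟨ sym (map-filter-allFin-accept P? (el ∘ τ) (trans (sym link₀) q)) ⟩
      map (el ∘ τ) (filter P? (allFin _)) ∎
    (no ¬q) → begin
      filter pos (map h (filter Q? (allFin (suc M))))
        ≡⟨ cong (filter pos) (map-filter-allFin-reject Q? h ¬q) ⟩
      filter pos (map (h ∘ suc) L)
        ≡⟨ rest ⟩
      map (el ∘ τ ∘ suc) (filter (P? ∘ suc) (allFin _))
        ≡⟨ sym (map-filter-allFin-reject P? (el ∘ τ) (¬q ∘ trans link₀)) ⟩
      map (el ∘ τ) (filter P? (allFin _)) ∎
  where
  pos = 1 ℕ.≤?_
  Q? = λ c → label c F.≟ v
  P? = λ j → label′ j F.≟ v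
  h : Fin (suc M) → ℕ
  h = toℕ ∘ fillFrom a ι τ
  L = filter (Q? ∘ suc) (allFin M)
  link₀ : label zero ≡ label′ zero
  link₀ = link zero zero (trans (ℕP.+-identityʳ a) (sym ι₀≡a))
  rest : filter pos (map (h ∘ suc) L) ≡ map (el ∘ τ ∘ suc) (filter (P? ∘ suc) (allFin _))
  rest = trans (cong (filter pos) (LP.map-cong (cong toℕ ∘ fillFrom-first ι ι₀≡a τ ∘ suc) L))
               (filter-fillFrom M (suc a) (ι ∘ suc) (mono-∘suc ι-mono) (first<tail ι-mono ι₀≡a)
                  (<-+-suc a ∘ ι<a+M ∘ suc) (label ∘ suc) (label′ ∘ suc)
                  (λ c j e → link (suc c) (suc j) (trans (ℕP.+-suc a (toℕ c)) e)) v (τ ∘ suc))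

seqSign-nonPerm : ∀ n {xs} → isPermB n xs ≡ false → seqSign n xs ≡ 0ℤ
seqSign-nonPerm n ¬perm rewrite ¬perm = refl

signPLH-nonLatin : ∀ {d k n} (C : Filling d k n) →
                   allB (λ ℓ → allB (λ v → isPermB n (sliceValues {d} {k} C ℓ v)) (allFin k)) (allFin d) ≡ false →
                   signPLH {d} {k} n C ≡ 0ℤ
signPLH-nonLatin {d} {k} {n} C ¬latin =
  prodℤ-vanishes (λ ℓ → allB (isSlicePerm ℓ) (allFin k)) _ (allFin d) ¬latin λ ℓ ¬latinℓ →
    prodℤ-vanishes (isSlicePerm ℓ) _ (allFin k) ¬latinℓ λ v → seqSign-nonPerm n {sliceValues {d} {k} C ℓ v}
  where
  isSlicePerm : Fin d → Fin k → Bool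
  isSlicePerm ℓ v = isPermB n (sliceValues {d} {k} C ℓ v)

signPLH-cong : ∀ {d k n} {C C′ : Filling d k n} → (∀ c → C c ≡ C′ c) →
               signPLH {d} {k} n C ≡ signPLH {d} {k} n C′
signPLH-cong {d} {k} {n} C≗C′ = prodℤ-cong (allFin d) λ ℓ → prodℤ-cong (allFin k) λ v →
  cong (seqSign n ∘ filter (1 ℕ.≤?_))
       (LP.map-cong (cong toℕ ∘ C≗C′) (filter (λ c → cell {d} {k} c ℓ F.≟ v) (allFin _)))

module _ {d N k n : ℕ} (T : Table d N k) (lex : ColumnsLexOrdered T) where

  private
    M = ncells d k

    columnRank : Fin N → ℕ
    columnRank j = lexRank (column T j)

    columnRank-mono : columnRank Preserves F._<_ ⟶ _<_
    columnRank-mono {j} {j′} j<j′ = lexRank-mono (lex j j′ j<j′)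

    columnRank-< : ∀ j → columnRank j < 0 + M
    columnRank-< j = subst (columnRank j <_) (sym (ncells≡ d k)) (lexRank-< (column T j))

    inTableB-cell : ∀ c → inTableB T (cell {d} {k} c) ≡ inImage columnRank (toℕ c)
    inTableB-cell c = anyB-cong (allFin N) λ j →
      trans (allB-==ᶠ≡lexRank-≡ᵇ (column T j) (cell {d} {k} c)) (cong (columnRank j ≡ᵇ_) (lexRank-cell {d} {k} c))

    supportIsColumns : Filling d k n → Bool
    supportIsColumns C = allB (λ c → nonzeroIff (C c) (inTableB T (cell {d} {k} c))) (allFin M)

    isPLH-*-signPLH : ∀ (C : Filling d k n) →
                      [ isPLH n T C ] ℤ.* signPLH {d} {k} n C ≡ [ supportIsImage 0 columnRank C ] ℤ.* signPLH {d} {k} n C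
    isPLH-*-signPLH C = trans ([]-∧-dropʳ (supportIsColumns C) _ _ (signPLH-nonLatin {d} {k} C))
      (cong (λ b → [ b ] ℤ.* signPLH {d} {k} n C)
            (allB-cong (allFin M) (λ c → cong (nonzeroIff (C c)) (inTableB-cell c))))

    slice-fillFrom : ∀ (τ : Fin N → Fin n) ℓ v →
                     sliceValues {d} {k} (fillFrom 0 columnRank τ) ℓ v ≡ map (el ∘ τ) (positions T ℓ v)
    slice-fillFrom τ ℓ v = filter-fillFrom M 0 columnRank columnRank-mono (λ _ → z≤n) columnRank-<
      (λ c → cell {d} {k} c ℓ) (λ j → T ℓ j)
      (λ c j e → lexRank-injective (cell {d} {k} c) (column T j) (trans (lexRank-cell {d} {k} c) e) ℓ) v τ

  AT≡sum-rowSigns : AT d k n T ≡ ∑[ τ ∈ allFuns N (allFin n) ] rowSigns n T τ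
  AT≡sum-rowSigns = begin
    ∑[ C ∈ allFuns M (allFin (suc n)) ] [ isPLH n T C ] ℤ.* signPLH {d} {k} n C
      ≡⟨ sumℤ-cong (allFuns M (allFin (suc n))) isPLH-*-signPLH ⟩
    ∑[ C ∈ allFuns M (allFin (suc n)) ] [ supportIsImage 0 columnRank C ] ℤ.* signPLH {d} {k} n C
      ≡⟨ sumℤ-supportIsImage M 0 columnRank columnRank-mono (λ _ → z≤n) columnRank-<
           (signPLH {d} {k} n) (signPLH-cong {d} {k} {n}) ⟩
    ∑[ τ ∈ allFuns N (allFin n) ] signPLH {d} {k} n (fillFrom 0 columnRank τ)
      ≡⟨ sumℤ-cong (allFuns N (allFin n)) (λ τ → prodℤ-cong (allFin d) λ ℓ → prodℤ-cong (allFin k) λ v →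
           cong (seqSign n) (slice-fillFrom τ ℓ v)) ⟩
    ∑[ τ ∈ allFuns N (allFin n) ] rowSigns n T τ ∎

proposition7p6 : (d n k : ℕ) → 0 < d → 0 < n → 0 < k →
    (T : Table d (n * k) k) →
    RowsBalanced n T → ColumnsDistinct T → ColumnsLexOrdered T →
    Δ n T (unitTensor n d) ≡ AT d k n T
proposition7p6 (suc d) n k _ _ _ T _ _ lex = trans (Δ-unitTensor n T) (sym (AT≡sum-rowSigns T lex))
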